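{- (a) For every integer $n\ge 0$, \[ \sum_{k=0}^{n}(-1)^{k}qq(k)\,\omega(n-k)=\begin{cases}1 & \text{if } n=0,\\ 2 & \text{if } n\ge1 \text{ is a perfect square and } n \text{ is even},\\ -2 & \text{if } n\ge1 \text{ is a perfect square and } n \text{ is odd},\\ 0 & \text{otherwise.}\end{cases} \] (b) For every integer $n\ge 0$, \[ q(n)+2\sum_{k\ge 1}(-1)^k\delta_s(k)\,q(n-k)=\omega(n). \]
   Context: $q(n)$ denotes the number of partitions of $n$ into distinct parts ($q(0)=1$, and $q(m)=0$ for $m<0$); $qq(n)$ denotes the number of partitions of $n$ into distinct odd parts ($qq(0)=1$). $\delta_s(n)=1$ if $n$ is a perfect square and $0$ otherwise. For integers $m$, $\omega(m)=1$ if $m=0$; $\omega(m)=(-1)^k$ if $m=\frac{3k^2\pm k}{2}$ for some positive integer $k$; $\omega(m)=0$ otherwise (in particular for $m<0$). -}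

module Defs where

open import Data.Nat using (ℕ; zero; suc; _+_; _*_; _∸_; _≤_; _<_; _≟_)
open import Data.Nat.Properties using (_≤?_)
open import Data.Integer using (ℤ; +_; -_) renaming (_+_ to _+ℤ_; _*_ to _*ℤ_)
open import Data.Bool using (Bool; true; false; if_then_else_)
open import Relation.Nullary.Decidable using (⌊_⌋)

sgn : ℕ → ℤ
sgn zero = + 1
sgn (suc k) = - sgn k

sum0 : (ℕ → ℤ) → ℕ → ℤ
sum0 f zero = f 0
sum0 f (suc n) = sum0 f n +ℤ f (suc n)

sum1 : (ℕ → ℤ) → ℕ → ℤ
sum1 f zero = + 0
sum1 f (suc n) = sum1 f n +ℤ f (suc n)

-- distPB m n = number of partitions of n into distinct parts, all parts ≤ m
-- (standard recursion: either m is not a part, or m is a part)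
distPB : ℕ → ℕ → ℕ
distPB zero zero = 1
distPB zero (suc n) = 0
distPB (suc m) n =
  distPB m n + (if ⌊ suc m ≤? n ⌋ then distPB m (n ∸ suc m) else 0)

q : ℕ → ℕ
q n = distPB n n

-- distOddPB m n = number of partitions of n into distinct odd parts,
-- all parts among 1,3,...,2m-1
distOddPB : ℕ → ℕ → ℕ
distOddPB zero zero = 1
distOddPB zero (suc n) = 0
distOddPB (suc m) n =
  distOddPB m n + (if ⌊ suc (2 * m) ≤? n ⌋ then distOddPB m (n ∸ suc (2 * m)) else 0)

-- qq n : partitions of n into distinct odd parts (parts ≤ 2n-1 suffice)
qq : ℕ → ℕ
qq n = distOddPB n n

eqInd : ℕ → ℕ → ℤ
eqInd a b = if ⌊ a ≟ b ⌋ then + 1 else + 0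

-- ω(m): 1 if m = 0; (-1)^k if m = (3k²±k)/2 for some k ≥ 1 (such k ≤ m); 0 otherwise.
-- m = (3k² ± k)/2  ⇔  2m = 3k² + k  or  2m + k = 3k²  (the two cases are
-- disjoint for k ≥ 1, and k is unique).
ω : ℕ → ℤ
ω zero = + 1
ω (suc m) = sum1 (λ k → sgn k *ℤ (eqInd (2 * suc m) (3 * (k * k) + k)
                                   +ℤ eqInd (2 * suc m + k) (3 * (k * k)))) (suc m)

isSquareB : ℕ → ℕ → Bool
isSquareB n zero = ⌊ 0 ≟ n ⌋
isSquareB n (suc j) = if ⌊ suc j * suc j ≟ n ⌋ then true else isSquareB n j

δs : ℕ → ℤ
δs n = if isSquareB n n then + 1 else + 0

isEven : ℕ → Bool
isEven zero = true
isEven (suc n) = if isEven n then false else true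

rhsA : ℕ → ℤ
rhsA zero = + 1
rhsA (suc n) = if isSquareB (suc n) (suc n)
               then (if isEven (suc n) then + 2 else - (+ 2))
               else + 0

{-# OPTIONS --safe #-}
-- In ℤ[[x]] write (a;x)ₙ = (1 - a)(1 - ax)⋯(1 - axⁿ⁻¹) and θ = Σ_{j ∈ ℤ} (-1)ʲ x^{j²}.
-- Part (b) says (-x;x)_∞ θ = Σ ω(k) xᵏ: it combines Gauss's identity (-x;x)_∞ θ = (x;x)_∞ with
-- Euler's pentagonal number theorem (x;x)_∞ = Σ ω(k) xᵏ. Part (a) says θ = (x;x²)_∞ Σ ω(k) xᵏ and
-- follows from (b) by Euler's identity (x;x²)_∞ (-x;x)_∞ = 1, which holds because
-- (x;x²)_∞ (-x;x)_∞ (x;x)_∞ = (x;x²)_∞ (x²;x²)_∞ = (x;x)_∞ and (x;x)_∞ has constant term 1.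
-- The two classical identities are limits of polynomial identities proved by telescoping along k + r = n:
--   Σ_{k+r=n} (-1)ᵏ x^{rk + k(3k+1)/2} (x^{k+1};x)ᵣ = 1 + Σ_{k=1}^{n} (-1)ᵏ (x^{k(3k-1)/2} + x^{k(3k+1)/2})   (Shanks),
--   Σ_{k+r=n} (-1)ᵏ x^{k(n+1)} (-x^{r+1};x)ₖ (x^{k+1};x)_{2r} = (-x;x)ₙ (1 + 2 Σ_{j=1}^{n} (-1)ʲ x^{j²}).
-- In degrees ≤ n only the terms k = 0, namely (x;x)ₙ and (x;x)_{2n}, survive.
module Submission where

open import Defs

module FormalPowerSeries where

  open import Algebra.Bundles using (CommutativeRing)
  open import Algebra.Structures using (IsCommutativeRing)
  import Algebra.Construct.Pointwise as Pointwise
  import Algebra.Solver.Ring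
  open import Algebra.Solver.Ring.AlmostCommutativeRing using (fromCommutativeRing; _-Raw-AlmostCommutative⟶_)
  open import Data.Maybe using (Maybe; just; nothing)
  open import Data.Nat using (ℕ; zero; suc; _+_; _*_; _∸_; _≤_; _<_; z≤n; s≤s; _≟_)
  import Data.Nat.Properties as ℕ
  open import Data.Integer as ℤ using (ℤ; 0ℤ; 1ℤ)
  import Data.Integer.Properties as ℤP
  open import Algebra.Properties.CommutativeSemigroup ℤP.+-commutativeSemigroup using (interchange; x∙yz≈y∙xz)
  open import Data.Integer.Tactic.RingSolver using (solve-∀)
  open import Data.Product using (_,_)
  open import Data.Sum using (inj₁; inj₂)
  open import Level using (0ℓ)
  open import Relation.Binary.PropositionalEquality
    using (_≡_; _≢_; refl; sym; trans; cong; cong₂; subst; module ≡-Reasoning)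
  open import Relation.Nullary using (yes; no; contradiction)
  import Relation.Binary.Reasoning.Setoid as SetoidReasoning

  Series : Set
  Series = ℕ → ℤ

  infix  4 _≈_
  infixl 6 _⊕_ _⊖_
  infixl 7 _⊛_ _·_
  infix  8 ⊖_ X^_

  _≈_ : Series → Series → Set
  f ≈ g = ∀ n → f n ≡ g n

  const : ℤ → Series
  const c zero    = c
  const c (suc n) = 0ℤ

  𝟘 𝟙 : Series
  𝟘 _ = 0ℤ
  𝟙   = const 1ℤ

  _⊕_ : Series → Series → Series
  (f ⊕ g) n = f n ℤ.+ g n

  ⊖_ : Series → Series
  (⊖ f) n = ℤ.- f n

  _⊖_ : Series → Series → Series
  f ⊖ g = f ⊕ ⊖ g

  _·_ : ℤ → Series → Series
  (c · f) n = c ℤ.* f n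

  tail : Series → Series
  tail f n = f (suc n)

  _⊛_ : Series → Series → Series
  (f ⊛ g) zero    = f 0 ℤ.* g 0
  (f ⊛ g) (suc n) = f 0 ℤ.* g (suc n) ℤ.+ (tail f ⊛ g) n

  ≈-refl : ∀ {f} → f ≈ f
  ≈-refl n = refl

  ≡⇒≈ : ∀ {f g} → f ≡ g → f ≈ g
  ≡⇒≈ refl = ≈-refl

  ≈-sym : ∀ {f g} → f ≈ g → g ≈ f
  ≈-sym p n = sym (p n)

  ≈-trans : ∀ {f g h} → f ≈ g → g ≈ h → f ≈ h
  ≈-trans p q n = trans (p n) (q n)

  ⊕-cong : ∀ {f f′ g g′} → f ≈ f′ → g ≈ g′ → f ⊕ g ≈ f′ ⊕ g′
  ⊕-cong p q n = cong₂ ℤ._+_ (p n) (q n)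

  ⊖-cong : ∀ {f f′} → f ≈ f′ → ⊖ f ≈ ⊖ f′
  ⊖-cong p n = cong ℤ.-_ (p n)

  ⊛-cong : ∀ {f f′ g g′} → f ≈ f′ → g ≈ g′ → f ⊛ g ≈ f′ ⊛ g′
  ⊛-cong p q zero    = cong₂ ℤ._*_ (p 0) (q 0)
  ⊛-cong p q (suc n) =
    cong₂ ℤ._+_ (cong₂ ℤ._*_ (p 0) (q (suc n))) (⊛-cong (λ i → p (suc i)) q n)

  ⊛-zeroˡ : ∀ g → 𝟘 ⊛ g ≈ 𝟘
  ⊛-zeroˡ g zero    = ℤP.*-zeroˡ (g 0)
  ⊛-zeroˡ g (suc n) = cong₂ ℤ._+_ (ℤP.*-zeroˡ (g (suc n))) (⊛-zeroˡ g n)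

  ⊛-identityˡ : ∀ f → 𝟙 ⊛ f ≈ f
  ⊛-identityˡ f zero    = ℤP.*-identityˡ (f 0)
  ⊛-identityˡ f (suc n) =
    trans (cong₂ ℤ._+_ (ℤP.*-identityˡ (f (suc n))) (⊛-zeroˡ f n)) (ℤP.+-identityʳ (f (suc n)))

  ·-⊛ : ∀ c f g → c · f ⊛ g ≈ c · (f ⊛ g)
  ·-⊛ c f g zero    = ℤP.*-assoc c (f 0) (g 0)
  ·-⊛ c f g (suc n) =
    trans (cong₂ ℤ._+_ (ℤP.*-assoc c (f 0) (g (suc n))) (·-⊛ c (tail f) g n))
          (sym (ℤP.*-distribˡ-+ c (f 0 ℤ.* g (suc n)) ((tail f ⊛ g) n)))

  const-⊛ : ∀ c f → const c ⊛ f ≈ c · f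
  const-⊛ c f zero    = refl
  const-⊛ c f (suc n) =
    trans (cong (λ x → c ℤ.* f (suc n) ℤ.+ x) (⊛-zeroˡ f n)) (ℤP.+-identityʳ (c ℤ.* f (suc n)))

  ⊛-distribʳ : ∀ f g h → (f ⊕ g) ⊛ h ≈ f ⊛ h ⊕ g ⊛ h
  ⊛-distribʳ f g h zero    = ℤP.*-distribʳ-+ (h 0) (f 0) (g 0)
  ⊛-distribʳ f g h (suc n) =
    trans (cong₂ ℤ._+_ (ℤP.*-distribʳ-+ (h (suc n)) (f 0) (g 0)) (⊛-distribʳ (tail f) (tail g) h n))
          (interchange (f 0 ℤ.* h (suc n)) (g 0 ℤ.* h (suc n)) ((tail f ⊛ h) n) ((tail g ⊛ h) n))

  ⊛-distribˡ : ∀ f g h → f ⊛ (g ⊕ h) ≈ f ⊛ g ⊕ f ⊛ h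
  ⊛-distribˡ f g h zero    = ℤP.*-distribˡ-+ (f 0) (g 0) (h 0)
  ⊛-distribˡ f g h (suc n) =
    trans (cong₂ ℤ._+_ (ℤP.*-distribˡ-+ (f 0) (g (suc n)) (h (suc n))) (⊛-distribˡ (tail f) g h n))
          (interchange (f 0 ℤ.* g (suc n)) (f 0 ℤ.* h (suc n)) ((tail f ⊛ g) n) ((tail f ⊛ h) n))

  ⊛-unfoldʳ : ∀ f g n → (f ⊛ g) (suc n) ≡ f (suc n) ℤ.* g 0 ℤ.+ (f ⊛ tail g) n
  ⊛-unfoldʳ f g zero    = ℤP.+-comm (f 0 ℤ.* g 1) (f 1 ℤ.* g 0)
  ⊛-unfoldʳ f g (suc n) =
    trans (cong (λ x → f 0 ℤ.* g (suc (suc n)) ℤ.+ x) (⊛-unfoldʳ (tail f) g n))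
          (x∙yz≈y∙xz (f 0 ℤ.* g (suc (suc n))) (f (suc (suc n)) ℤ.* g 0) ((tail f ⊛ tail g) n))

  ⊛-comm : ∀ f g → f ⊛ g ≈ g ⊛ f
  ⊛-comm f g zero    = ℤP.*-comm (f 0) (g 0)
  ⊛-comm f g (suc n) =
    trans (cong₂ ℤ._+_ (ℤP.*-comm (f 0) (g (suc n))) (⊛-comm (tail f) g n)) (sym (⊛-unfoldʳ g f n))

  ⊛-assoc : ∀ f g h → (f ⊛ g) ⊛ h ≈ f ⊛ (g ⊛ h)
  ⊛-assoc f g h zero    = ℤP.*-assoc (f 0) (g 0) (h 0)
  ⊛-assoc f g h (suc n) =
    trans (cong₂ ℤ._+_ (ℤP.*-assoc (f 0) (g 0) (h (suc n))) tail-assoc)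
          (regroup (f 0) (g 0 ℤ.* h (suc n)) ((tail g ⊛ h) n) ((tail f ⊛ (g ⊛ h)) n))
    where
    -- tail (f ⊛ g) unfolds to f 0 · tail g ⊕ tail f ⊛ g.
    tail-assoc : (tail (f ⊛ g) ⊛ h) n ≡ f 0 ℤ.* (tail g ⊛ h) n ℤ.+ (tail f ⊛ (g ⊛ h)) n
    tail-assoc = trans (⊛-distribʳ (f 0 · tail g) (tail f ⊛ g) h n)
                       (cong₂ ℤ._+_ (·-⊛ (f 0) (tail g) h n) (⊛-assoc (tail f) g h n))
    regroup : ∀ a b c d → a ℤ.* b ℤ.+ (a ℤ.* c ℤ.+ d) ≡ a ℤ.* (b ℤ.+ c) ℤ.+ d
    regroup = solve-∀

  ⊛-isCommutativeRing : IsCommutativeRing _≈_ _⊕_ _⊛_ ⊖_ 𝟘 𝟙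
  ⊛-isCommutativeRing = record
    { isRing = record
      { +-isAbelianGroup = Pointwise.isAbelianGroup ℕ ℤP.+-0-isAbelianGroup
      ; *-cong           = ⊛-cong
      ; *-assoc          = ⊛-assoc
      ; *-identity       = ⊛-identityˡ , λ f → ≈-trans (⊛-comm f 𝟙) (⊛-identityˡ f)
      ; distrib          = ⊛-distribˡ , λ h f g → ⊛-distribʳ f g h
      }
    ; *-comm = ⊛-comm
    }

  seriesRing : CommutativeRing 0ℓ 0ℓ
  seriesRing = record { isCommutativeRing = ⊛-isCommutativeRing }

  module ≈-Reasoning = SetoidReasoning (CommutativeRing.setoid seriesRing)

  constHomomorphism :
    CommutativeRing.rawRing ℤP.+-*-commutativeRing -Raw-AlmostCommutative⟶ fromCommutativeRing seriesRing
  constHomomorphism = record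
    { ⟦_⟧    = const
    ; +-homo = λ a b → λ { zero → refl ; (suc n) → refl }
    ; *-homo = λ a b → λ { zero → refl ; (suc n) → sym (trans (const-⊛ a (const b) (suc n)) (ℤP.*-zeroʳ a)) }
    ; -‿homo = λ a → λ { zero → refl ; (suc n) → refl }
    ; 0-homo = λ { zero → refl ; (suc n) → refl }
    ; 1-homo = λ n → refl
    }

  const-≟ : ∀ a b → Maybe (const a ≈ const b)
  const-≟ a b with a ℤ.≟ b
  ... | yes refl = just ≈-refl
  ... | no _     = nothing

  module Solver = Algebra.Solver.Ring
    (CommutativeRing.rawRing ℤP.+-*-commutativeRing) (fromCommutativeRing seriesRing) constHomomorphism const-≟

  infix 4 _≈[_]_

  _≈[_]_ : Series → ℕ → Series → Set
  f ≈[ N ] g = ∀ m → m ≤ N → f m ≡ g m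

  ≈⇒≈[] : ∀ {f g} N → f ≈ g → f ≈[ N ] g
  ≈⇒≈[] N p m _ = p m

  ≈[]-sym : ∀ {N f g} → f ≈[ N ] g → g ≈[ N ] f
  ≈[]-sym p m m≤N = sym (p m m≤N)

  ≈[]-trans : ∀ {N f g h} → f ≈[ N ] g → g ≈[ N ] h → f ≈[ N ] h
  ≈[]-trans p q m m≤N = trans (p m m≤N) (q m m≤N)

  ≈[]-weaken : ∀ {M N f g} → M ≤ N → f ≈[ N ] g → f ≈[ M ] g
  ≈[]-weaken M≤N p m m≤M = p m (ℕ.≤-trans m≤M M≤N)

  ≈[]-extend : ∀ {N f g} → f ≈[ N ] g → f (suc N) ≡ g (suc N) → f ≈[ suc N ] g
  ≈[]-extend p eq m m≤1+N with ℕ.m≤n⇒m<n∨m≡n m≤1+N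
  ... | inj₁ (s≤s m≤N) = p m m≤N
  ... | inj₂ refl      = eq

  ⊕-cong-≈[] : ∀ {N f f′ g g′} → f ≈[ N ] f′ → g ≈[ N ] g′ → f ⊕ g ≈[ N ] f′ ⊕ g′
  ⊕-cong-≈[] p q m m≤N = cong₂ ℤ._+_ (p m m≤N) (q m m≤N)

  ⊛-cong-≈[] : ∀ {N f f′ g g′} → f ≈[ N ] f′ → g ≈[ N ] g′ → f ⊛ g ≈[ N ] f′ ⊛ g′
  ⊛-cong-≈[] p q zero    _ = cong₂ ℤ._*_ (p 0 z≤n) (q 0 z≤n)
  ⊛-cong-≈[] {suc N} p q (suc m) (s≤s m≤N) =
    cong₂ ℤ._+_ (cong₂ ℤ._*_ (p 0 z≤n) (q (suc m) (s≤s m≤N)))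
                (⊛-cong-≈[] {N} (λ i i≤N → p (suc i) (s≤s i≤N)) (λ i i≤N → q i (ℕ.m≤n⇒m≤1+n i≤N)) m m≤N)

  ⊛-≈[]𝟘ˡ : ∀ {N f} g → f ≈[ N ] 𝟘 → f ⊛ g ≈[ N ] 𝟘
  ⊛-≈[]𝟘ˡ {N} g f≈𝟘 = ≈[]-trans (⊛-cong-≈[] f≈𝟘 (λ _ _ → refl)) (≈⇒≈[] N (⊛-zeroˡ g))

  ⊛-≈[]𝟘ʳ : ∀ {N g} f → g ≈[ N ] 𝟘 → f ⊛ g ≈[ N ] 𝟘
  ⊛-≈[]𝟘ʳ {N} {g} f g≈𝟘 = ≈[]-trans (≈⇒≈[] N (⊛-comm f g)) (⊛-≈[]𝟘ˡ f g≈𝟘)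

  Approximates : (ℕ → Series) → Series → Set
  Approximates F f = ∀ N → F N ≈[ N ] f

  approximates-unique : ∀ {F f g} → Approximates F f → Approximates F g → f ≈ g
  approximates-unique p q m = trans (sym (p m m ℕ.≤-refl)) (q m m ℕ.≤-refl)

  approximates-beyond : ∀ {F f N M} → Approximates F f → N ≤ M → F M ≈[ N ] f
  approximates-beyond {M = M} p N≤M = ≈[]-weaken N≤M (p M)

  approximates-resp-≈ : ∀ {F f g} → Approximates F f → f ≈ g → Approximates F g
  approximates-resp-≈ p f≈g N m m≤N = trans (p N m m≤N) (f≈g m)

  approximates-≈[] : ∀ {F G f} → (∀ N → F N ≈[ N ] G N) → Approximates G f → Approximates F f
  approximates-≈[] p q N = ≈[]-trans (p N) (q N)

  approximates-⊛ : ∀ {F G f g} → Approximates F f → Approximates G g → Approximates (λ N → F N ⊛ G N) (f ⊛ g)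
  approximates-⊛ p q N = ⊛-cong-≈[] (p N) (q N)

  diagonal : (ℕ → Series) → Series
  diagonal F m = F m m

  stable⇒approximates-diagonal : ∀ {F} → (∀ N → F (suc N) ≈[ N ] F N) → Approximates F (diagonal F)
  stable⇒approximates-diagonal stable zero    zero z≤n = refl
  stable⇒approximates-diagonal stable (suc N) m m≤1+N with ℕ.m≤n⇒m<n∨m≡n m≤1+N
  ... | inj₁ (s≤s m≤N) = trans (stable N m m≤N) (stable⇒approximates-diagonal stable N m m≤N)
  ... | inj₂ refl      = refl

  shift : Series → Series
  shift f zero    = 0ℤ
  shift f (suc n) = f n

  X^_ : ℕ → Series
  X^ zero  = 𝟙
  X^ suc e = shift (X^ e)

  shift-⊛ : ∀ f g → shift f ⊛ g ≈ shift (f ⊛ g)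
  shift-⊛ f g zero    = ℤP.*-zeroˡ (g 0)
  shift-⊛ f g (suc n) =
    trans (cong (ℤ._+ (f ⊛ g) n) (ℤP.*-zeroˡ (g (suc n)))) (ℤP.+-identityˡ ((f ⊛ g) n))

  X^-cong : ∀ {a b} → a ≡ b → X^ a ≈ X^ b
  X^-cong refl = ≈-refl

  eqInd-resp-⇔ : ∀ {a b c d} → (a ≡ b → c ≡ d) → (c ≡ d → a ≡ b) → eqInd a b ≡ eqInd c d
  eqInd-resp-⇔ {a} {b} {c} {d} to from with a ≟ b | c ≟ d
  ... | yes a≡b | yes _   = refl
  ... | yes a≡b | no c≢d  = contradiction (to a≡b) c≢d
  ... | no a≢b  | yes c≡d = contradiction (from c≡d) a≢b
  ... | no _    | no _    = refl

  eqInd-≡ : ∀ {a b} → a ≡ b → eqInd a b ≡ 1ℤ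
  eqInd-≡ {a} {b} a≡b with a ≟ b
  ... | yes _   = refl
  ... | no  a≢b = contradiction a≡b a≢b

  eqInd-≢ : ∀ {a b} → a ≢ b → eqInd a b ≡ 0ℤ
  eqInd-≢ {a} {b} a≢b with a ≟ b
  ... | yes a≡b = contradiction a≡b a≢b
  ... | no  _   = refl

  X^-coeff : ∀ e m → (X^ e) m ≡ eqInd m e
  X^-coeff zero    zero    = refl
  X^-coeff zero    (suc m) = refl
  X^-coeff (suc e) zero    = refl
  X^-coeff (suc e) (suc m) = trans (X^-coeff e m) (eqInd-resp-⇔ (cong suc) ℕ.suc-injective)

  X^-+ : ∀ a b → X^ (a + b) ≈ X^ a ⊛ X^ b
  X^-+ zero    b = ≈-sym (⊛-identityˡ (X^ b))
  X^-+ (suc a) b n = trans (shift-cong (X^-+ a b) n) (sym (shift-⊛ (X^ a) (X^ b) n))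
    where
    shift-cong : ∀ {f g} → f ≈ g → shift f ≈ shift g
    shift-cong p zero    = refl
    shift-cong p (suc n) = p n

  X^-≈[]𝟘 : ∀ {N e} → N < e → X^ e ≈[ N ] 𝟘
  X^-≈[]𝟘 {e = suc e} N<e zero    _           = refl
  X^-≈[]𝟘 {suc N} {suc e} (s≤s N<e) (suc m) (s≤s m≤N) = X^-≈[]𝟘 N<e m m≤N

  X^-≡-+ : ∀ {e} a b → e ≡ a + b → X^ e ≈ X^ a ⊛ X^ b
  X^-≡-+ a b refl = X^-+ a b

  X^-≡-+-+ : ∀ {e} a b c → e ≡ a + b + c → X^ e ≈ X^ a ⊛ X^ b ⊛ X^ c
  X^-≡-+-+ a b c refl = ≈-trans (X^-+ (a + b) c) (⊛-cong (X^-+ a b) ≈-refl)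

  X^-⊛-coeff-< : ∀ e f m → m < e → (X^ e ⊛ f) m ≡ 0ℤ
  X^-⊛-coeff-< e f m m<e = ⊛-≈[]𝟘ˡ f (X^-≈[]𝟘 m<e) m ℕ.≤-refl

  X^-⊛-coeff : ∀ e f m → e ≤ m → (X^ e ⊛ f) m ≡ f (m ∸ e)
  X^-⊛-coeff zero    f m       _         = ⊛-identityˡ f m
  X^-⊛-coeff (suc e) f (suc m) (s≤s e≤m) = trans (shift-⊛ (X^ e) f (suc m)) (X^-⊛-coeff e f m e≤m)

  ∏ : (ℕ → Series) → ℕ → ℕ → Series
  ∏ F a zero    = 𝟙
  ∏ F a (suc l) = F a ⊛ ∏ F (suc a) l

  ∏-cong : ∀ {F G} → (∀ i → F i ≈ G i) → ∀ a l → ∏ F a l ≈ ∏ G a l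
  ∏-cong F≈G a zero    = ≈-refl
  ∏-cong F≈G a (suc l) = ⊛-cong (F≈G a) (∏-cong F≈G (suc a) l)

  ∏-snoc : ∀ F a l → ∏ F a (suc l) ≈ ∏ F a l ⊛ F (a + l)
  ∏-snoc F a zero    n = trans (⊛-comm (F a) 𝟙 n) (cong (λ i → (𝟙 ⊛ F i) n) (sym (ℕ.+-identityʳ a)))
  ∏-snoc F a (suc l) n = begin
    (F a ⊛ ∏ F (suc a) (suc l)) n           ≡⟨ ⊛-cong (≈-refl {F a}) (∏-snoc F (suc a) l) n ⟩
    (F a ⊛ (∏ F (suc a) l ⊛ F (suc a + l))) n ≡⟨ sym (⊛-assoc (F a) (∏ F (suc a) l) (F (suc a + l)) n) ⟩
    (∏ F a (suc l) ⊛ F (suc a + l)) n        ≡⟨ cong (λ i → (∏ F a (suc l) ⊛ F i) n) (sym (ℕ.+-suc a l)) ⟩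
    (∏ F a (suc l) ⊛ F (a + suc l)) n        ∎
    where open ≡-Reasoning

  ∏-≈[]-stable : ∀ F a → (∀ N → F (a + N) ≈[ N ] 𝟙) → ∀ N → ∏ F a (suc N) ≈[ N ] ∏ F a N
  ∏-≈[]-stable F a near𝟙 N = ≈[]-trans (≈⇒≈[] N (∏-snoc F a N))
    (≈[]-trans (⊛-cong-≈[] (λ _ _ → refl) (near𝟙 N))
               (≈⇒≈[] N (≈-trans (⊛-comm (∏ F a N) 𝟙) (⊛-identityˡ (∏ F a N)))))

  ∏-⊛ : ∀ F G a l → ∏ F a l ⊛ ∏ G a l ≈ ∏ (λ i → F i ⊛ G i) a l
  ∏-⊛ F G a zero    = ⊛-identityˡ 𝟙
  ∏-⊛ F G a (suc l) = ≈-trans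
    (solve 4 (λ f g P Q → (f :* P) :* (g :* Q) := (f :* g) :* (P :* Q)) ≈-refl
           (F a) (G a) (∏ F (suc a) l) (∏ G (suc a) l))
    (⊛-cong (≈-refl {F a ⊛ G a}) (∏-⊛ F G (suc a) l))
    where open Solver

  Σ₁ : (ℕ → Series) → ℕ → Series
  Σ₁ F zero    = 𝟘
  Σ₁ F (suc N) = Σ₁ F N ⊕ F (suc N)

  Σ₁-coeff : ∀ F N m → Σ₁ F N m ≡ sum1 (λ k → F k m) N
  Σ₁-coeff F zero    m = refl
  Σ₁-coeff F (suc N) m = cong (ℤ._+ F (suc N) m) (Σ₁-coeff F N m)

  Σ₁-≈[]-stable : ∀ F → (∀ N → F (suc N) ≈[ N ] 𝟘) → ∀ N → Σ₁ F (suc N) ≈[ N ] Σ₁ F N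
  Σ₁-≈[]-stable F small N m m≤N =
    trans (cong (λ x → Σ₁ F N m ℤ.+ x) (small N m m≤N)) (ℤP.+-identityʳ (Σ₁ F N m))

  antidiagonal : (ℕ → ℕ → Series) → ℕ → Series
  antidiagonal F zero    = F 0 0
  antidiagonal F (suc n) = F 0 (suc n) ⊕ antidiagonal (λ a → F (suc a)) n

  antidiagonal-last : ∀ F n → antidiagonal F (suc n) ≈ antidiagonal (λ a b → F a (suc b)) n ⊕ F (suc n) 0
  antidiagonal-last F zero    = ≈-refl
  antidiagonal-last F (suc n) = ≈-trans
    (⊕-cong (≈-refl {F 0 (suc (suc n))}) (antidiagonal-last (λ a → F (suc a)) n))
    (λ m → sym (ℤP.+-assoc (F 0 (suc (suc n)) m) _ _))

  antidiagonal-telescoping :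
    ∀ (F G : ℕ → ℕ → Series) c (E : ℕ → ℕ → Series) n →
    (∀ a b → a + b ≡ n → F a b ≈ c ⊛ G a b ⊕ (E (suc a) b ⊖ E a (suc b))) →
    antidiagonal F n ≈ c ⊛ antidiagonal G n ⊕ (E (suc n) 0 ⊖ E 0 (suc n))
  antidiagonal-telescoping F G c E zero    step = step 0 0 refl
  antidiagonal-telescoping F G c E (suc n) step = begin
    F 0 (suc n) ⊕ antidiagonal (λ a → F (suc a)) n
      ≈⟨ ⊕-cong (step 0 (suc n) refl)
                (antidiagonal-telescoping (λ a → F (suc a)) (λ a → G (suc a)) c (λ a → E (suc a)) n
                  (λ a b eq → step (suc a) b (cong suc eq))) ⟩
    c ⊛ G 0 (suc n) ⊕ (E 1 (suc n) ⊖ E 0 (suc (suc n)))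
      ⊕ (c ⊛ antidiagonal (λ a → G (suc a)) n ⊕ (E (suc (suc n)) 0 ⊖ E 1 (suc n)))
      ≈⟨ solve 6 (λ c g s e₀ e₁ e₂ → c :* g :+ (e₁ :- e₀) :+ (c :* s :+ (e₂ :- e₁)) := c :* (g :+ s) :+ (e₂ :- e₀))
               ≈-refl c (G 0 (suc n)) (antidiagonal (λ a → G (suc a)) n) (E 0 (suc (suc n))) (E 1 (suc n)) (E (suc (suc n)) 0) ⟩
    c ⊛ antidiagonal G (suc n) ⊕ (E (suc (suc n)) 0 ⊖ E 0 (suc (suc n)))  ∎
    where
    open ≈-Reasoning
    open Solver

  antidiagonal-≈[]𝟘 : ∀ {N} (F : ℕ → ℕ → Series) n →
    (∀ a b → a + b ≡ n → F a b ≈[ N ] 𝟘) → antidiagonal F n ≈[ N ] 𝟘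
  antidiagonal-≈[]𝟘 F zero    small = small 0 0 refl
  antidiagonal-≈[]𝟘 F (suc n) small m m≤N =
    cong₂ ℤ._+_ (small 0 (suc n) refl m m≤N)
                (antidiagonal-≈[]𝟘 (λ a → F (suc a)) n (λ a b eq → small (suc a) b (cong suc eq)) m m≤N)

  antidiagonal-≈[]-head : ∀ (F : ℕ → ℕ → Series) n →
    (∀ a b → F (suc a) b ≈[ suc a + b ] 𝟘) → antidiagonal F n ≈[ n ] F 0 n
  antidiagonal-≈[]-head F zero    small m m≤n = refl
  antidiagonal-≈[]-head F (suc n) small m m≤n =
    trans (cong (λ x → F 0 (suc n) m ℤ.+ x) (antidiagonal-≈[]𝟘 (λ a → F (suc a)) n tail-small m m≤n))
          (ℤP.+-identityʳ (F 0 (suc n) m))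
    where
    tail-small : ∀ a b → a + b ≡ n → F (suc a) b ≈[ suc n ] 𝟘
    tail-small a b a+b≡n = subst (λ N → F (suc a) b ≈[ N ] 𝟘) (cong suc a+b≡n) (small a b)

  ⊛-cancelʳ : ∀ {f g u} → u 0 ≡ 1ℤ → f ⊛ u ≈ g ⊛ u → f ≈ g
  ⊛-cancelʳ {f} {g} {u} u₀≡1 fu≈gu n = ℤP.i-j≡0⇒i≡j (f n) (g n) (d≈[]𝟘 n n ℕ.≤-refl)
    where
    open Solver
    d : Series
    d = f ⊖ g
    du≈𝟘 : d ⊛ u ≈ 𝟘
    du≈𝟘 m = trans (solve 3 (λ f g u → (f :- g) :* u := f :* u :- g :* u) ≈-refl f g u m)
                   (trans (cong (λ x → (f ⊛ u) m ℤ.+ ℤ.- x) (sym (fu≈gu m))) (ℤP.+-inverseʳ ((f ⊛ u) m)))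
    leading : ∀ m → d m ℤ.* u 0 ≡ 0ℤ → d m ≡ 0ℤ
    leading m eq = trans (sym (ℤP.*-identityʳ (d m))) (trans (cong (d m ℤ.*_) (sym u₀≡1)) eq)
    -- Once d vanishes up to degree N, the coefficient of degree N + 1 of d ⊛ u is d (N + 1) * u 0.
    d≈[]𝟘 : ∀ N → d ≈[ N ] 𝟘
    d≈[]𝟘 zero    zero z≤n = leading 0 (du≈𝟘 0)
    d≈[]𝟘 (suc N) = ≈[]-extend (d≈[]𝟘 N) (leading (suc N) (begin
      d (suc N) ℤ.* u 0                        ≡⟨ sym (ℤP.+-identityʳ _) ⟩
      d (suc N) ℤ.* u 0 ℤ.+ 0ℤ                 ≡⟨ cong (λ x → d (suc N) ℤ.* u 0 ℤ.+ x) (sym lower-terms) ⟩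
      d (suc N) ℤ.* u 0 ℤ.+ (d ⊛ tail u) N     ≡⟨ sym (⊛-unfoldʳ d u N) ⟩
      (d ⊛ u) (suc N)                          ≡⟨ du≈𝟘 (suc N) ⟩
      0ℤ                                       ∎))
      where
      open ≡-Reasoning
      lower-terms : (d ⊛ tail u) N ≡ 0ℤ
      lower-terms = ⊛-≈[]𝟘ˡ (tail u) (d≈[]𝟘 N) N ℕ.≤-refl

  sum0-unfoldˡ : ∀ h n → sum0 h (suc n) ≡ h 0 ℤ.+ sum0 (λ k → h (suc k)) n
  sum0-unfoldˡ h zero    = refl
  sum0-unfoldˡ h (suc n) = trans (cong (ℤ._+ h (suc (suc n))) (sum0-unfoldˡ h n)) (ℤP.+-assoc (h 0) _ _)

  ⊛-coeff : ∀ f g n → (f ⊛ g) n ≡ sum0 (λ k → f k ℤ.* g (n ∸ k)) n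
  ⊛-coeff f g zero    = refl
  ⊛-coeff f g (suc n) = trans (cong (λ x → f 0 ℤ.* g (suc n) ℤ.+ x) (⊛-coeff (tail f) g n))
                              (sym (sum0-unfoldˡ (λ k → f k ℤ.* g (suc n ∸ k)) n))

  sum0-split : ∀ f n → sum0 f n ≡ f 0 ℤ.+ sum1 f n
  sum0-split f zero    = sym (ℤP.+-identityʳ (f 0))
  sum0-split f (suc n) = trans (cong (ℤ._+ f (suc n)) (sum0-split f n)) (ℤP.+-assoc (f 0) _ _)

  sum1-cong : ∀ {f g} n → (∀ k → f (suc k) ≡ g (suc k)) → sum1 f n ≡ sum1 g n
  sum1-cong zero    f≡g = refl
  sum1-cong (suc n) f≡g = cong₂ ℤ._+_ (sum1-cong n f≡g) (f≡g n)

  sum1-*ˡ : ∀ c f n → sum1 (λ k → c ℤ.* f k) n ≡ c ℤ.* sum1 f n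
  sum1-*ˡ c f zero    = sym (ℤP.*-zeroʳ c)
  sum1-*ˡ c f (suc n) = trans (cong (ℤ._+ c ℤ.* f (suc n)) (sum1-*ˡ c f n)) (sym (ℤP.*-distribˡ-+ c (sum1 f n) (f (suc n))))

module PartitionIdentities where

  open FormalPowerSeries
  open import Algebra.Bundles using (CommutativeRing)
  open import Data.Bool using (true; false; if_then_else_)
  open import Data.Nat using (ℕ; zero; suc; _+_; _*_; _∸_; _≤_; _<_; z≤n; s≤s; _≟_; _≤?_)
  import Data.Nat.Properties as ℕ
  open import Data.Nat.Tactic.RingSolver using (solve-∀)
  open import Data.Integer as ℤ using (ℤ; +_; 0ℤ; 1ℤ)
  import Data.Integer.Tactic.RingSolver as ZSolver
  import Data.Integer.Properties as ℤP
  open import Relation.Binary.PropositionalEquality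
    using (_≡_; _≢_; refl; sym; trans; cong; cong₂; subst; module ≡-Reasoning)
  open import Relation.Nullary using (yes; no; contradiction)
  open Solver using (solve; _:=_; _:+_; _:*_; :-_; _:-_; con)
  module R = CommutativeRing seriesRing

  infix 8 𝟙-X^_ 𝟙+X^_

  𝟙-X^_ 𝟙+X^_ : ℕ → Series
  𝟙-X^ i = 𝟙 ⊖ X^ i
  𝟙+X^ i = 𝟙 ⊕ X^ i

  const-sgn-suc : ∀ k → const (sgn (suc k)) ≈ ⊖ const (sgn k)
  const-sgn-suc k zero    = refl
  const-sgn-suc k (suc n) = refl

  eulerProduct : ℕ → Series
  eulerProduct n = ∏ 𝟙-X^_ 1 n

  -- Shanks' identity

  pentagonal : ℕ → ℕ
  pentagonal zero    = 0
  pentagonal (suc k) = suc (3 * k + pentagonal k)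

  pentagonalTerm : ℕ → Series
  pentagonalTerm k = const (sgn k) ⊛ (X^ (pentagonal k + k) ⊕ X^ pentagonal k)

  pentagonalSum : ℕ → Series
  pentagonalSum N = 𝟙 ⊕ Σ₁ pentagonalTerm N

  shanksTerm : ℕ → ℕ → Series
  shanksTerm k r = const (sgn k) ⊛ X^ (r * k + (pentagonal k + k)) ⊛ ∏ 𝟙-X^_ (suc k) r

  shanksCorrection : ℕ → ℕ → Series
  shanksCorrection j s = const (sgn j) ⊛ X^ (s * j + pentagonal j) ⊛ ∏ 𝟙-X^_ j s

  shanksTerm-step : ∀ k r →
    shanksTerm k (suc r) ≈ 𝟙 ⊛ shanksTerm k r ⊕ (shanksCorrection (suc k) r ⊖ shanksCorrection k (suc r))
  shanksTerm-step k r = begin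
    shanksTerm k (suc r)
      ≈⟨ ⊛-cong (⊛-cong (≈-refl {σ}) (X^-≡-+ e k (longer-exponent r k (pentagonal k)))) (∏-snoc 𝟙-X^_ (suc k) r) ⟩
    σ ⊛ (x ⊛ a) ⊛ (A ⊛ (𝟙 ⊖ b))
      ≈⟨ solve 5 (λ σ x a b A → σ :* (x :* a) :* (A :* (con 1ℤ :- b)) :=
                   con 1ℤ :* (σ :* x :* A) :+ ((:- σ) :* (x :* a :* b) :* A :- σ :* x :* ((con 1ℤ :- a) :* A)))
               ≈-refl σ x a b A ⟩
    𝟙 ⊛ (σ ⊛ x ⊛ A) ⊕ ((⊖ σ) ⊛ (x ⊛ a ⊛ b) ⊛ A ⊖ σ ⊛ x ⊛ ((𝟙 ⊖ a) ⊛ A))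
      ≈⟨ ⊕-cong (≈-refl {𝟙 ⊛ shanksTerm k r})
           (⊕-cong (⊛-cong (⊛-cong (≈-sym (const-sgn-suc k))
                                   (≈-sym (≈-trans (X^-≡-+ (e + k) (suc (k + r)) (next-exponent r k (pentagonal k)))
                                                   (⊛-cong (X^-+ e k) ≈-refl))))
                           ≈-refl)
                   (⊖-cong (⊛-cong (⊛-cong (≈-refl {σ}) (X^-cong (sym (correction-exponent r k (pentagonal k)))))
                                   ≈-refl))) ⟩
    𝟙 ⊛ shanksTerm k r ⊕ (shanksCorrection (suc k) r ⊖ shanksCorrection k (suc r))  ∎
    where
    open ≈-Reasoning
    e : ℕ
    e = r * k + (pentagonal k + k)
    σ x a b A : Series
    σ = const (sgn k)
    x = X^ e
    a = X^ k
    b = X^ suc (k + r)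
    A = ∏ 𝟙-X^_ (suc k) r
    longer-exponent : ∀ r k p → suc r * k + (p + k) ≡ r * k + (p + k) + k
    longer-exponent = solve-∀
    correction-exponent : ∀ r k p → suc r * k + p ≡ r * k + (p + k)
    correction-exponent = solve-∀
    next-exponent : ∀ r k p → r * suc k + suc (3 * k + p) ≡ r * k + (p + k) + k + suc (k + r)
    next-exponent = solve-∀

  shanksCorrection-vanishes : ∀ s → shanksCorrection 0 (suc s) ≈ 𝟘
  shanksCorrection-vanishes s = ≈-trans
    (⊛-cong (≈-refl {const 1ℤ ⊛ X^ (suc s * 0 + 0)})
            (≈-trans (⊛-cong (R.-‿inverseʳ 𝟙) (≈-refl {∏ 𝟙-X^_ 1 s})) (⊛-zeroˡ (∏ 𝟙-X^_ 1 s))))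
    (R.zeroʳ _)

  shanks : ∀ n → antidiagonal shanksTerm n ≈ pentagonalSum n
  shanks zero    = ≈-trans (≈-trans (R.*-identityʳ (𝟙 ⊛ 𝟙)) (⊛-identityˡ 𝟙)) (≈-sym (R.+-identityʳ 𝟙))
  shanks (suc p) = begin
    antidiagonal shanksTerm (suc p)
      ≈⟨ antidiagonal-last shanksTerm p ⟩
    antidiagonal (λ k r → shanksTerm k (suc r)) p ⊕ shanksTerm (suc p) 0
      ≈⟨ ⊕-cong (antidiagonal-telescoping (λ k r → shanksTerm k (suc r)) shanksTerm 𝟙 shanksCorrection p
                   (λ k r _ → shanksTerm-step k r))
                ≈-refl ⟩
    𝟙 ⊛ antidiagonal shanksTerm p ⊕ (shanksCorrection (suc p) 0 ⊖ shanksCorrection 0 (suc p)) ⊕ shanksTerm (suc p) 0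
      ≈⟨ ⊕-cong (⊕-cong (⊛-cong (≈-refl {𝟙}) (shanks p)) (⊕-cong (≈-refl {shanksCorrection (suc p) 0})
                                                                 (⊖-cong (shanksCorrection-vanishes p))))
                ≈-refl ⟩
    𝟙 ⊛ pentagonalSum p ⊕ (shanksCorrection (suc p) 0 ⊖ 𝟘) ⊕ shanksTerm (suc p) 0
      ≈⟨ solve 5 (λ S σ u v z → con 1ℤ :* (con 1ℤ :+ S) :+ (σ :* v :* con 1ℤ :- z) :+ σ :* u :* con 1ℤ
                                  := con 1ℤ :+ (S :+ σ :* (u :+ v)) :- z)
               ≈-refl (Σ₁ pentagonalTerm p) (const (sgn (suc p))) (X^ (pentagonal (suc p) + suc p))
               (X^ pentagonal (suc p)) 𝟘 ⟩
    pentagonalSum (suc p) ⊖ 𝟘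
      ≈⟨ R.+-identityʳ (pentagonalSum (suc p)) ⟩
    pentagonalSum (suc p)  ∎
    where open ≈-Reasoning

  shanksTerm-≈[]𝟘 : ∀ a b → shanksTerm (suc a) b ≈[ suc a + b ] 𝟘
  shanksTerm-≈[]𝟘 a b =
    ⊛-≈[]𝟘ˡ (∏ 𝟙-X^_ (suc (suc a)) b) (⊛-≈[]𝟘ʳ (const (sgn (suc a))) (X^-≈[]𝟘 exponent-large))
    where
    open ℕ.≤-Reasoning
    exponent-large : suc a + b < b * suc a + (pentagonal (suc a) + suc a)
    exponent-large = begin-strict
      suc a + b                                   <⟨ ℕ.n<1+n _ ⟩
      suc (suc a + b)                             ≡⟨ cong suc (ℕ.+-comm (suc a) b) ⟩
      suc (b + suc a)                             ≡⟨ sym (ℕ.+-suc b (suc a)) ⟩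
      b + suc (suc a)
        ≤⟨ ℕ.+-mono-≤ (ℕ.m≤m*n b (suc a)) (s≤s (ℕ.m≤n+m (suc a) (3 * a + pentagonal a))) ⟩
      b * suc a + (pentagonal (suc a) + suc a)    ∎

  shanks-≈[] : ∀ n → antidiagonal shanksTerm n ≈[ n ] eulerProduct n
  shanks-≈[] n = ≈[]-trans
    (antidiagonal-≈[]-head shanksTerm n shanksTerm-≈[]𝟘)
    (≈⇒≈[] n (≈-trans (⊛-cong (⊛-cong (≈-refl {𝟙}) (X^-cong (trans (ℕ.+-identityʳ (n * 0)) (ℕ.*-zeroʳ n)))) ≈-refl)
                      (≈-trans (⊛-cong (⊛-identityˡ 𝟙) ≈-refl) (⊛-identityˡ (eulerProduct n)))))

  -- A finite form of Gauss's identity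

  distinctPartsProduct : ℕ → Series
  distinctPartsProduct n = ∏ 𝟙+X^_ 1 n

  thetaTerm : ℕ → Series
  thetaTerm j = const (+ 2) ⊛ (const (sgn j) ⊛ X^ (j * j))

  thetaSum : ℕ → Series
  thetaSum N = 𝟙 ⊕ Σ₁ thetaTerm N

  gaussTerm : ℕ → ℕ → Series
  gaussTerm k r = const (sgn k) ⊛ X^ (k * suc (k + r)) ⊛ ∏ 𝟙+X^_ (suc r) k ⊛ ∏ 𝟙-X^_ (suc k) (r + r)

  -- The case r = 0 is forced by gaussTerm-step at r = 0. Being (-x;x)ₖ times the k-th theta term,
  -- it turns the telescoping into the recurrence of distinctPartsProduct n ⊛ thetaSum n.
  gaussCorrection : ℕ → ℕ → Series
  gaussCorrection k zero    = distinctPartsProduct k ⊛ thetaTerm k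
  gaussCorrection k (suc s) =
    const (sgn k) ⊛ X^ (k * (k + suc s)) ⊛ 𝟙-X^ ((k + suc s) + (k + suc s))
      ⊛ ∏ 𝟙+X^_ (suc s) k ⊛ ∏ 𝟙-X^_ (suc k) (s + suc s)

  module GaussBoundaryStep (k : ℕ) where

    σ x Y P : Series
    σ = const (sgn k)
    x = X^ (k * suc k)
    Y = X^ suc k
    P = distinctPartsProduct k

    k+1≡1+k : k + 1 ≡ suc k
    k+1≡1+k = ℕ.+-comm k 1

    term-suc : gaussTerm (suc k) 0 ≈ (⊖ σ) ⊛ (x ⊛ Y ⊛ Y) ⊛ (P ⊛ (𝟙 ⊕ Y)) ⊛ 𝟙
    term-suc = ⊛-cong (⊛-cong (⊛-cong (const-sgn-suc k) (X^-≡-+-+ (k * suc k) (suc k) (suc k) (exponent k)))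
                              (∏-snoc 𝟙+X^_ 1 k))
                      ≈-refl
      where
      exponent : ∀ k → suc k * suc (suc k + 0) ≡ k * suc k + suc k + suc k
      exponent = solve-∀

    factor : 𝟙+X^ suc (k + 0) ≈ 𝟙 ⊕ Y
    factor = ⊕-cong (≈-refl {𝟙}) (X^-cong (cong suc (ℕ.+-identityʳ k)))

    term : gaussTerm k 0 ≈ σ ⊛ x ⊛ P ⊛ 𝟙
    term = ⊛-cong (⊛-cong (⊛-cong (≈-refl {σ}) (X^-cong (cong (λ i → k * suc i) (ℕ.+-identityʳ k)))) ≈-refl) ≈-refl

    correction-suc : gaussCorrection (suc k) 0 ≈ (P ⊛ (𝟙 ⊕ Y)) ⊛ (const (+ 2) ⊛ ((⊖ σ) ⊛ (x ⊛ Y)))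
    correction-suc = ⊛-cong (∏-snoc 𝟙+X^_ 1 k)
      (⊛-cong (≈-refl {const (+ 2)}) (⊛-cong (const-sgn-suc k) (X^-≡-+ (k * suc k) (suc k) (exponent k))))
      where
      exponent : ∀ k → suc k * suc k ≡ k * suc k + suc k
      exponent = solve-∀

    correction : gaussCorrection k 1 ≈ σ ⊛ x ⊛ (𝟙 ⊖ Y ⊛ Y) ⊛ P ⊛ ((𝟙 ⊖ Y) ⊛ 𝟙)
    correction =
      ⊛-cong (⊛-cong (⊛-cong (⊛-cong (≈-refl {σ}) (X^-cong (cong (k *_) k+1≡1+k)))
                             (⊕-cong (≈-refl {𝟙}) (⊖-cong (X^-≡-+ (suc k) (suc k) (cong₂ _+_ k+1≡1+k k+1≡1+k)))))
                     ≈-refl)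
             ≈-refl

    step : gaussTerm (suc k) 0 ≈ 𝟙+X^ suc (k + 0) ⊛ gaussTerm k 0 ⊕ (gaussCorrection (suc k) 0 ⊖ gaussCorrection k 1)
    step = begin
      gaussTerm (suc k) 0
        ≈⟨ term-suc ⟩
      (⊖ σ) ⊛ (x ⊛ Y ⊛ Y) ⊛ (P ⊛ (𝟙 ⊕ Y)) ⊛ 𝟙
        ≈⟨ solve 4 (λ σ x Y P →
             (:- σ) :* (x :* Y :* Y) :* (P :* (con 1ℤ :+ Y)) :* con 1ℤ
             := (con 1ℤ :+ Y) :* (σ :* x :* P :* con 1ℤ)
                :+ ((P :* (con 1ℤ :+ Y)) :* (con (+ 2) :* ((:- σ) :* (x :* Y)))
                    :- σ :* x :* (con 1ℤ :- Y :* Y) :* P :* ((con 1ℤ :- Y) :* con 1ℤ)))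
             ≈-refl σ x Y P ⟩
      (𝟙 ⊕ Y) ⊛ (σ ⊛ x ⊛ P ⊛ 𝟙)
        ⊕ ((P ⊛ (𝟙 ⊕ Y)) ⊛ (const (+ 2) ⊛ ((⊖ σ) ⊛ (x ⊛ Y)))
           ⊖ σ ⊛ x ⊛ (𝟙 ⊖ Y ⊛ Y) ⊛ P ⊛ ((𝟙 ⊖ Y) ⊛ 𝟙))
        ≈⟨ ≈-sym (⊕-cong (⊛-cong factor term) (⊕-cong correction-suc (⊖-cong correction))) ⟩
      𝟙+X^ suc (k + 0) ⊛ gaussTerm k 0 ⊕ (gaussCorrection (suc k) 0 ⊖ gaussCorrection k 1)  ∎
      where open ≈-Reasoning

  module GaussInteriorStep (k s : ℕ) where

    σ x Z U B R : Series
    σ = const (sgn k)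
    x = X^ (k * suc (k + suc s))
    Z = X^ suc k
    U = X^ suc s
    B = ∏ 𝟙+X^_ (suc (suc s)) k
    R = ∏ 𝟙-X^_ (suc (suc k)) (s + suc s)

    𝟙-ZUU : 𝟙-X^ (suc (suc k) + (s + suc s)) ≈ 𝟙 ⊖ Z ⊛ U ⊛ U
    𝟙-ZUU = ⊕-cong (≈-refl {𝟙}) (⊖-cong (X^-≡-+-+ (suc k) (suc s) (suc s) (exponent k s)))
      where
      exponent : ∀ k s → suc (suc k) + (s + suc s) ≡ suc k + suc s + suc s
      exponent = solve-∀

    𝟙-ZUZU : ∀ {n} → n ≡ (suc k + suc s) + (suc k + suc s) → 𝟙-X^ n ≈ 𝟙 ⊖ Z ⊛ U ⊛ (Z ⊛ U)
    𝟙-ZUZU eq = ⊕-cong (≈-refl {𝟙}) (⊖-cong (≈-trans (X^-≡-+ (suc k + suc s) (suc k + suc s) eq)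
                                                     (⊛-cong (X^-+ (suc k) (suc s)) (X^-+ (suc k) (suc s)))))

    term-suc :
      gaussTerm (suc k) (suc s) ≈ (⊖ σ) ⊛ (x ⊛ Z ⊛ (Z ⊛ U)) ⊛ (B ⊛ (𝟙 ⊕ Z ⊛ U)) ⊛ (R ⊛ (𝟙 ⊖ Z ⊛ U ⊛ U))
    term-suc =
      ⊛-cong (⊛-cong (⊛-cong (const-sgn-suc k)
                             (≈-trans (X^-≡-+-+ (k * suc (k + suc s)) (suc k) (suc k + suc s) (exponent k s))
                                      (⊛-cong (≈-refl {x ⊛ Z}) (X^-+ (suc k) (suc s)))))
                     (≈-trans (∏-snoc 𝟙+X^_ (suc (suc s)) k)
                              (⊛-cong (≈-refl {B}) (⊕-cong (≈-refl {𝟙}) (X^-≡-+ (suc k) (suc s) (swap s k))))))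
             (≈-trans (∏-snoc 𝟙-X^_ (suc (suc k)) (s + suc s)) (⊛-cong (≈-refl {R}) 𝟙-ZUU))
      where
      exponent : ∀ k s → suc k * suc (suc k + suc s) ≡ k * suc (k + suc s) + suc k + (suc k + suc s)
      exponent = solve-∀
      swap : ∀ s k → suc (suc s) + k ≡ suc k + suc s
      swap = solve-∀

    correction-suc :
      gaussCorrection (suc k) (suc s) ≈ (⊖ σ) ⊛ (x ⊛ (Z ⊛ U)) ⊛ (𝟙 ⊖ Z ⊛ U ⊛ (Z ⊛ U)) ⊛ ((𝟙 ⊕ U) ⊛ B) ⊛ R
    correction-suc =
      ⊛-cong (⊛-cong (⊛-cong (⊛-cong (const-sgn-suc k)
                                     (≈-trans (X^-≡-+ (k * suc (k + suc s)) (suc k + suc s) (exponent k s))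
                                              (⊛-cong (≈-refl {x}) (X^-+ (suc k) (suc s)))))
                             (𝟙-ZUZU refl))
                     ≈-refl)
             ≈-refl
      where
      exponent : ∀ k s → suc k * (suc k + suc s) ≡ k * suc (k + suc s) + (suc k + suc s)
      exponent = solve-∀

    correction :
      gaussCorrection k (suc (suc s)) ≈ σ ⊛ x ⊛ (𝟙 ⊖ Z ⊛ U ⊛ (Z ⊛ U)) ⊛ B ⊛ ((𝟙 ⊖ Z) ⊛ (R ⊛ (𝟙 ⊖ Z ⊛ U ⊛ U)))
    correction =
      ⊛-cong (⊛-cong (⊛-cong (⊛-cong (≈-refl {σ}) (X^-cong (cong (k *_) (ℕ.+-suc k (suc s)))))
                             (𝟙-ZUZU (exponent k s)))
                     ≈-refl)
             (⊛-cong (≈-refl {𝟙-X^ suc k})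
                     (≈-trans (≡⇒≈ (cong (∏ 𝟙-X^_ (suc (suc k))) (ℕ.+-suc s (suc s))))
                              (≈-trans (∏-snoc 𝟙-X^_ (suc (suc k)) (s + suc s)) (⊛-cong (≈-refl {R}) 𝟙-ZUU))))
      where
      exponent : ∀ k s → (k + suc (suc s)) + (k + suc (suc s)) ≡ (suc k + suc s) + (suc k + suc s)
      exponent = solve-∀

    step : gaussTerm (suc k) (suc s)
             ≈ 𝟙+X^ suc (k + suc s) ⊛ gaussTerm k (suc s) ⊕ (gaussCorrection (suc k) (suc s) ⊖ gaussCorrection k (suc (suc s)))
    step = begin
      gaussTerm (suc k) (suc s)
        ≈⟨ term-suc ⟩
      (⊖ σ) ⊛ (x ⊛ Z ⊛ (Z ⊛ U)) ⊛ (B ⊛ (𝟙 ⊕ Z ⊛ U)) ⊛ (R ⊛ (𝟙 ⊖ Z ⊛ U ⊛ U))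
        ≈⟨ solve 6 (λ σ x Z U B R →
             (:- σ) :* (x :* Z :* (Z :* U)) :* (B :* (con 1ℤ :+ Z :* U)) :* (R :* (con 1ℤ :- Z :* U :* U))
             := (con 1ℤ :+ Z :* U) :* (σ :* x :* B :* ((con 1ℤ :- Z) :* R))
                :+ ((:- σ) :* (x :* (Z :* U)) :* (con 1ℤ :- Z :* U :* (Z :* U)) :* ((con 1ℤ :+ U) :* B) :* R
                    :- σ :* x :* (con 1ℤ :- Z :* U :* (Z :* U)) :* B :* ((con 1ℤ :- Z) :* (R :* (con 1ℤ :- Z :* U :* U)))))
             ≈-refl σ x Z U B R ⟩
      (𝟙 ⊕ Z ⊛ U) ⊛ (σ ⊛ x ⊛ B ⊛ ((𝟙 ⊖ Z) ⊛ R))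
        ⊕ ((⊖ σ) ⊛ (x ⊛ (Z ⊛ U)) ⊛ (𝟙 ⊖ Z ⊛ U ⊛ (Z ⊛ U)) ⊛ ((𝟙 ⊕ U) ⊛ B) ⊛ R
           ⊖ σ ⊛ x ⊛ (𝟙 ⊖ Z ⊛ U ⊛ (Z ⊛ U)) ⊛ B ⊛ ((𝟙 ⊖ Z) ⊛ (R ⊛ (𝟙 ⊖ Z ⊛ U ⊛ U))))
        ≈⟨ ≈-sym (⊕-cong (⊛-cong (⊕-cong (≈-refl {𝟙}) (X^-+ (suc k) (suc s))) ≈-refl)
                         (⊕-cong correction-suc (⊖-cong correction))) ⟩
      𝟙+X^ suc (k + suc s) ⊛ gaussTerm k (suc s) ⊕ (gaussCorrection (suc k) (suc s) ⊖ gaussCorrection k (suc (suc s)))  ∎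
      where open ≈-Reasoning

  gaussTerm-step : ∀ k r →
    gaussTerm (suc k) r ≈ 𝟙+X^ suc (k + r) ⊛ gaussTerm k r ⊕ (gaussCorrection (suc k) r ⊖ gaussCorrection k (suc r))
  gaussTerm-step k zero    = GaussBoundaryStep.step k
  gaussTerm-step k (suc s) = GaussInteriorStep.step k s

  gaussTerm-0≈gaussCorrection-0 : ∀ n → gaussTerm 0 (suc n) ≈ gaussCorrection 0 (suc n)
  gaussTerm-0≈gaussCorrection-0 n = ≈-trans
    (⊛-cong (≈-refl {𝟙 ⊛ 𝟙 ⊛ 𝟙}) (∏-snoc 𝟙-X^_ 1 (n + suc n)))
    (solve 2 (λ A M → con 1ℤ :* con 1ℤ :* con 1ℤ :* (A :* M) := con 1ℤ :* con 1ℤ :* M :* con 1ℤ :* A)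
           ≈-refl (∏ 𝟙-X^_ 1 (n + suc n)) (𝟙-X^ (suc n + suc n)))

  gauss-recurrence : ∀ n →
    antidiagonal gaussTerm (suc n) ≈ 𝟙+X^ suc n ⊛ antidiagonal gaussTerm n ⊕ gaussCorrection (suc n) 0
  gauss-recurrence n = begin
    gaussTerm 0 (suc n) ⊕ antidiagonal (λ a → gaussTerm (suc a)) n
      ≈⟨ ⊕-cong (gaussTerm-0≈gaussCorrection-0 n)
                (antidiagonal-telescoping (λ a → gaussTerm (suc a)) gaussTerm (𝟙+X^ suc n) gaussCorrection n
                   (λ a b a+b≡n → subst (λ m → gaussTerm (suc a) b ≈ 𝟙+X^ suc m ⊛ gaussTerm a b ⊕ _)
                                        a+b≡n (gaussTerm-step a b))) ⟩
    V₀ ⊕ (c ⊛ A ⊕ (V ⊖ V₀))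
      ≈⟨ solve 4 (λ V₀ c A V → V₀ :+ (c :* A :+ (V :- V₀)) := c :* A :+ V) ≈-refl V₀ c A V ⟩
    c ⊛ A ⊕ V  ∎
    where
    open ≈-Reasoning
    V₀ V c A : Series
    V₀ = gaussCorrection 0 (suc n)
    V  = gaussCorrection (suc n) 0
    c  = 𝟙+X^ suc n
    A  = antidiagonal gaussTerm n

  gauss : ∀ n → antidiagonal gaussTerm n ≈ distinctPartsProduct n ⊛ thetaSum n
  gauss zero    = ≈-trans (solve 0 (con 1ℤ :* con 1ℤ :* con 1ℤ :* con 1ℤ := con 1ℤ) ≈-refl)
                          (≈-sym (≈-trans (⊛-identityˡ (𝟙 ⊕ 𝟘)) (R.+-identityʳ 𝟙)))
  gauss (suc n) = begin
    antidiagonal gaussTerm (suc n)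
      ≈⟨ gauss-recurrence n ⟩
    c ⊛ antidiagonal gaussTerm n ⊕ distinctPartsProduct (suc n) ⊛ thetaTerm (suc n)
      ≈⟨ ⊕-cong (⊛-cong (≈-refl {c}) (gauss n)) (⊛-cong (∏-snoc 𝟙+X^_ 1 n) ≈-refl) ⟩
    c ⊛ (P ⊛ (𝟙 ⊕ S)) ⊕ P ⊛ c ⊛ t
      ≈⟨ solve 4 (λ c P S t → c :* (P :* (con 1ℤ :+ S)) :+ P :* c :* t := P :* c :* (con 1ℤ :+ (S :+ t)))
               ≈-refl c P S t ⟩
    P ⊛ c ⊛ thetaSum (suc n)
      ≈⟨ ⊛-cong (≈-sym (∏-snoc 𝟙+X^_ 1 n)) ≈-refl ⟩
    distinctPartsProduct (suc n) ⊛ thetaSum (suc n)  ∎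
    where
    open ≈-Reasoning
    c P S t : Series
    c = 𝟙+X^ suc n
    P = distinctPartsProduct n
    S = Σ₁ thetaTerm n
    t = thetaTerm (suc n)

  gaussTerm-≈[]𝟘 : ∀ a b → gaussTerm (suc a) b ≈[ suc a + b ] 𝟘
  gaussTerm-≈[]𝟘 a b =
    ⊛-≈[]𝟘ˡ (∏ 𝟙-X^_ (suc (suc a)) (b + b)) (⊛-≈[]𝟘ˡ (∏ 𝟙+X^_ (suc b) (suc a))
      (⊛-≈[]𝟘ʳ (const (sgn (suc a))) (X^-≈[]𝟘 (ℕ.m≤n*m (suc (suc a + b)) (suc a)))))

  gauss-≈[] : ∀ n → antidiagonal gaussTerm n ≈[ n ] eulerProduct (n + n)
  gauss-≈[] n = ≈[]-trans
    (antidiagonal-≈[]-head gaussTerm n gaussTerm-≈[]𝟘)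
    (≈⇒≈[] n (solve 1 (λ E → con 1ℤ :* con 1ℤ :* con 1ℤ :* E := E) ≈-refl (eulerProduct (n + n))))

  -- Euler's identity

  oddPartsProduct : ℕ → Series
  oddPartsProduct n = ∏ (λ i → 𝟙-X^ suc (2 * i)) 0 n

  evenPartsProduct : ℕ → Series
  evenPartsProduct n = ∏ (λ i → 𝟙-X^ (2 * i)) 1 n

  distinctPartsProduct-⊛-eulerProduct : ∀ n → distinctPartsProduct n ⊛ eulerProduct n ≈ evenPartsProduct n
  distinctPartsProduct-⊛-eulerProduct n = ≈-trans (∏-⊛ 𝟙+X^_ 𝟙-X^_ 1 n) (∏-cong difference-of-squares 1 n)
    where
    difference-of-squares : ∀ i → 𝟙+X^ i ⊛ 𝟙-X^ i ≈ 𝟙-X^ (2 * i)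
    difference-of-squares i = ≈-trans
      (solve 1 (λ y → (con 1ℤ :+ y) :* (con 1ℤ :- y) := con 1ℤ :- y :* y) ≈-refl (X^ i))
      (⊕-cong (≈-refl {𝟙}) (⊖-cong (≈-sym (X^-≡-+ i i (cong (λ j → i + j) (ℕ.+-identityʳ i))))))

  oddPartsProduct-⊛-evenPartsProduct : ∀ n → oddPartsProduct n ⊛ evenPartsProduct n ≈ eulerProduct (2 * n)
  oddPartsProduct-⊛-evenPartsProduct zero    = ⊛-identityˡ 𝟙
  oddPartsProduct-⊛-evenPartsProduct (suc n) = begin
    oddPartsProduct (suc n) ⊛ evenPartsProduct (suc n)
      ≈⟨ ⊛-cong (∏-snoc (λ i → 𝟙-X^ suc (2 * i)) 0 n) (∏-snoc (λ i → 𝟙-X^ (2 * i)) 1 n) ⟩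
    oddPartsProduct n ⊛ 𝟙-X^ suc (2 * n) ⊛ (evenPartsProduct n ⊛ 𝟙-X^ (2 * suc n))
      ≈⟨ solve 4 (λ O a E b → O :* a :* (E :* b) := O :* E :* a :* b) ≈-refl
               (oddPartsProduct n) (𝟙-X^ suc (2 * n)) (evenPartsProduct n) (𝟙-X^ (2 * suc n)) ⟩
    oddPartsProduct n ⊛ evenPartsProduct n ⊛ 𝟙-X^ suc (2 * n) ⊛ 𝟙-X^ (2 * suc n)
      ≈⟨ ⊛-cong (⊛-cong (oddPartsProduct-⊛-evenPartsProduct n) ≈-refl) (≡⇒≈ (cong 𝟙-X^_ (ℕ.*-suc 2 n))) ⟩
    eulerProduct (2 * n) ⊛ 𝟙-X^ suc (2 * n) ⊛ 𝟙-X^ suc (suc (2 * n))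
      ≈⟨ ≈-sym (≈-trans (∏-snoc 𝟙-X^_ 1 (suc (2 * n))) (⊛-cong (∏-snoc 𝟙-X^_ 1 (2 * n)) ≈-refl)) ⟩
    eulerProduct (suc (suc (2 * n)))
      ≈⟨ ≡⇒≈ (cong eulerProduct (sym (ℕ.*-suc 2 n))) ⟩
    eulerProduct (2 * suc n)  ∎
    where open ≈-Reasoning

  sgn-+ : ∀ a b → sgn (a + b) ≡ sgn a ℤ.* sgn b
  sgn-+ zero    b = sym (ℤP.*-identityˡ (sgn b))
  sgn-+ (suc a) b = trans (cong ℤ.-_ (sgn-+ a b)) (ℤP.neg-distribˡ-* (sgn a) (sgn b))

  sgn-double : ∀ n → sgn (n + n) ≡ 1ℤ
  sgn-double zero    = refl
  sgn-double (suc n) = trans (cong (λ m → ℤ.- sgn m) (ℕ.+-suc n n)) (trans (ℤP.neg-involutive _) (sgn-double n))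

  sgn-square : ∀ a → sgn (a * a) ≡ sgn a
  sgn-square zero    = refl
  sgn-square (suc a) = begin
    sgn (suc a * suc a)               ≡⟨ sgn-+ (suc a) (a * suc a) ⟩
    sgn (suc a) ℤ.* sgn (a * suc a)   ≡⟨ cong (λ m → sgn (suc a) ℤ.* sgn m) (trans (ℕ.*-suc a a) (ℕ.+-comm a (a * a))) ⟩
    sgn (suc a) ℤ.* sgn (a * a + a)   ≡⟨ cong (sgn (suc a) ℤ.*_) (sgn-+ (a * a) a) ⟩
    sgn (suc a) ℤ.* (sgn (a * a) ℤ.* sgn a)
      ≡⟨ cong (λ s → sgn (suc a) ℤ.* (s ℤ.* sgn a)) (sgn-square a) ⟩
    sgn (suc a) ℤ.* (sgn a ℤ.* sgn a) ≡⟨ cong (sgn (suc a) ℤ.*_) (trans (sym (sgn-+ a a)) (sgn-double a)) ⟩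
    sgn (suc a) ℤ.* 1ℤ                ≡⟨ ℤP.*-identityʳ (sgn (suc a)) ⟩
    sgn (suc a)                       ∎
    where open ≡-Reasoning

  sgn-∸-odd : ∀ n m → suc (2 * n) ≤ m → sgn (m ∸ suc (2 * n)) ≡ ℤ.- sgn m
  sgn-∸-odd n m e≤m = begin
    sgn (m ∸ e)                     ≡⟨ sym (ℤP.neg-involutive _) ⟩
    ℤ.- (ℤ.- sgn (m ∸ e))           ≡⟨ cong ℤ.-_ (sym (ℤP.-1*i≡-i (sgn (m ∸ e)))) ⟩
    ℤ.- (ℤ.-1ℤ ℤ.* sgn (m ∸ e))     ≡⟨ cong (λ s → ℤ.- (s ℤ.* sgn (m ∸ e))) (sym (cong ℤ.-_ sgn-2n)) ⟩
    ℤ.- (sgn e ℤ.* sgn (m ∸ e))     ≡⟨ cong ℤ.-_ (sym (sgn-+ e (m ∸ e))) ⟩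
    ℤ.- sgn (e + (m ∸ e))           ≡⟨ cong (λ k → ℤ.- sgn k) (ℕ.m+[n∸m]≡n e≤m) ⟩
    ℤ.- sgn m                       ∎
    where
    open ≡-Reasoning
    e : ℕ
    e = suc (2 * n)
    sgn-2n : sgn (2 * n) ≡ 1ℤ
    sgn-2n = trans (cong sgn (cong (λ j → n + j) (ℕ.+-identityʳ n))) (sgn-double n)

  sgn-isEven : ∀ n → sgn n ≡ (if isEven n then 1ℤ else ℤ.-1ℤ)
  sgn-isEven zero = refl
  sgn-isEven (suc n) with isEven n | sgn-isEven n
  ... | true  | sgn-n = cong ℤ.-_ sgn-n
  ... | false | sgn-n = cong ℤ.-_ sgn-n

  distinctPartsProduct-suc-coeff : ∀ N m →
    distinctPartsProduct (suc N) m ≡ distinctPartsProduct N m ℤ.+ (X^ suc N ⊛ distinctPartsProduct N) m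
  distinctPartsProduct-suc-coeff N m = trans (∏-snoc 𝟙+X^_ 1 N m)
    (solve 2 (λ P y → P :* (con 1ℤ :+ y) := P :+ y :* P) ≈-refl (distinctPartsProduct N) (X^ suc N) m)

  distinctPartsProduct-coeff : ∀ N m → distinctPartsProduct N m ≡ + distPB N m
  distinctPartsProduct-coeff zero    zero    = refl
  distinctPartsProduct-coeff zero    (suc m) = refl
  distinctPartsProduct-coeff (suc N) m with suc N ≤? m
  ... | yes e≤m = trans (distinctPartsProduct-suc-coeff N m)
    (trans (cong₂ ℤ._+_ (distinctPartsProduct-coeff N m)
                        (trans (X^-⊛-coeff (suc N) (distinctPartsProduct N) m e≤m) (distinctPartsProduct-coeff N (m ∸ suc N))))
           (sym (ℤP.pos-+ (distPB N m) _)))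
  ... | no e≰m = trans (distinctPartsProduct-suc-coeff N m)
    (trans (cong₂ ℤ._+_ (distinctPartsProduct-coeff N m)
                        (X^-⊛-coeff-< (suc N) (distinctPartsProduct N) m (ℕ.≰⇒> e≰m)))
           (sym (ℤP.pos-+ (distPB N m) 0)))

  oddPartsProduct-suc-coeff : ∀ N m →
    oddPartsProduct (suc N) m ≡ oddPartsProduct N m ℤ.- (X^ suc (2 * N) ⊛ oddPartsProduct N) m
  oddPartsProduct-suc-coeff N m = trans (∏-snoc (λ i → 𝟙-X^ suc (2 * i)) 0 N m)
    (solve 2 (λ O y → O :* (con 1ℤ :- y) := O :- y :* O) ≈-refl (oddPartsProduct N) (X^ suc (2 * N)) m)

  oddPartsProduct-coeff : ∀ N m → oddPartsProduct N m ≡ sgn m ℤ.* + distOddPB N m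
  oddPartsProduct-coeff zero    zero    = refl
  oddPartsProduct-coeff zero    (suc m) = sym (ℤP.*-zeroʳ (sgn (suc m)))
  oddPartsProduct-coeff (suc N) m with suc (2 * N) ≤? m
  ... | yes e≤m = begin
    oddPartsProduct (suc N) m
      ≡⟨ oddPartsProduct-suc-coeff N m ⟩
    oddPartsProduct N m ℤ.- (X^ e ⊛ oddPartsProduct N) m
      ≡⟨ cong₂ ℤ._-_ (oddPartsProduct-coeff N m)
                     (trans (X^-⊛-coeff e (oddPartsProduct N) m e≤m) (oddPartsProduct-coeff N (m ∸ e))) ⟩
    sgn m ℤ.* + distOddPB N m ℤ.- sgn (m ∸ e) ℤ.* + distOddPB N (m ∸ e)
      ≡⟨ cong (λ s → sgn m ℤ.* + distOddPB N m ℤ.- s ℤ.* + distOddPB N (m ∸ e)) (sgn-∸-odd N m e≤m) ⟩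
    sgn m ℤ.* + distOddPB N m ℤ.- ℤ.- sgn m ℤ.* + distOddPB N (m ∸ e)
      ≡⟨ factor-sign (sgn m) (+ distOddPB N m) (+ distOddPB N (m ∸ e)) ⟩
    sgn m ℤ.* (+ distOddPB N m ℤ.+ + distOddPB N (m ∸ e))
      ≡⟨ cong (sgn m ℤ.*_) (sym (ℤP.pos-+ (distOddPB N m) _)) ⟩
    sgn m ℤ.* + (distOddPB N m + distOddPB N (m ∸ e))  ∎
    where
    open ≡-Reasoning
    e : ℕ
    e = suc (2 * N)
    factor-sign : ∀ s a b → s ℤ.* a ℤ.- ℤ.- s ℤ.* b ≡ s ℤ.* (a ℤ.+ b)
    factor-sign = ZSolver.solve-∀
  ... | no e≰m = begin
    oddPartsProduct (suc N) m
      ≡⟨ oddPartsProduct-suc-coeff N m ⟩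
    oddPartsProduct N m ℤ.- (X^ suc (2 * N) ⊛ oddPartsProduct N) m
      ≡⟨ cong₂ ℤ._-_ (oddPartsProduct-coeff N m) (X^-⊛-coeff-< (suc (2 * N)) (oddPartsProduct N) m (ℕ.≰⇒> e≰m)) ⟩
    sgn m ℤ.* + distOddPB N m ℤ.+ 0ℤ
      ≡⟨ ℤP.+-identityʳ _ ⟩
    sgn m ℤ.* + distOddPB N m
      ≡⟨ cong (λ d → sgn m ℤ.* + d) (sym (ℕ.+-identityʳ (distOddPB N m))) ⟩
    sgn m ℤ.* + (distOddPB N m + 0)  ∎
    where open ≡-Reasoning

  isSquareB-false : ∀ M J → (∀ i → i ≤ J → i * i ≢ M) → isSquareB M J ≡ false
  isSquareB-false M zero    no-root with 0 ≟ M
  ... | yes 0≡M = contradiction 0≡M (no-root 0 z≤n)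
  ... | no  _   = refl
  isSquareB-false M (suc J) no-root with suc J * suc J ≟ M
  ... | yes root = contradiction root (no-root (suc J) ℕ.≤-refl)
  ... | no  _    = isSquareB-false M J (λ i i≤J → no-root i (ℕ.m≤n⇒m≤1+n i≤J))

  sum1-signed-squares : ∀ M J →
    sum1 (λ j → sgn j ℤ.* eqInd (suc M) (j * j)) J ≡ sgn (suc M) ℤ.* (if isSquareB (suc M) J then 1ℤ else 0ℤ)
  sum1-signed-squares M zero    = sym (ℤP.*-zeroʳ (sgn (suc M)))
  sum1-signed-squares M (suc J) with suc J * suc J ≟ suc M
  ... | yes root = begin
    sum1 f J ℤ.+ sgn (suc J) ℤ.* eqInd (suc M) (suc J * suc J)
      ≡⟨ cong₂ ℤ._+_ (sum1-signed-squares M J) (cong (sgn (suc J) ℤ.*_) (eqInd-≡ (sym root))) ⟩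
    sgn (suc M) ℤ.* (if isSquareB (suc M) J then 1ℤ else 0ℤ) ℤ.+ sgn (suc J) ℤ.* 1ℤ
      ≡⟨ cong₂ (λ b s → sgn (suc M) ℤ.* (if b then 1ℤ else 0ℤ) ℤ.+ s ℤ.* 1ℤ)
               (isSquareB-false (suc M) J smaller-roots) (trans (sym (sgn-square (suc J))) (cong sgn root)) ⟩
    sgn (suc M) ℤ.* 0ℤ ℤ.+ sgn (suc M) ℤ.* 1ℤ
      ≡⟨ cong (ℤ._+ sgn (suc M) ℤ.* 1ℤ) (ℤP.*-zeroʳ (sgn (suc M))) ⟩
    0ℤ ℤ.+ sgn (suc M) ℤ.* 1ℤ
      ≡⟨ ℤP.+-identityˡ _ ⟩
    sgn (suc M) ℤ.* 1ℤ  ∎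
    where
    open ≡-Reasoning
    f : ℕ → ℤ
    f j = sgn j ℤ.* eqInd (suc M) (j * j)
    smaller-roots : ∀ i → i ≤ J → i * i ≢ suc M
    smaller-roots i i≤J i²≡M = ℕ.<⇒≢ (ℕ.*-mono-< (s≤s i≤J) (s≤s i≤J)) (trans i²≡M (sym root))
  ... | no not-root = trans
    (cong₂ ℤ._+_ (sum1-signed-squares M J) (cong (sgn (suc J) ℤ.*_) (eqInd-≢ (λ eq → not-root (sym eq)))))
    (trans (cong (λ x → sgn (suc M) ℤ.* (if isSquareB (suc M) J then 1ℤ else 0ℤ) ℤ.+ x) (ℤP.*-zeroʳ (sgn (suc J))))
           (ℤP.+-identityʳ _))

  pentagonal-double : ∀ k → 2 * pentagonal k + k ≡ 3 * (k * k)
  pentagonal-double zero    = refl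
  pentagonal-double (suc k) = begin
    2 * pentagonal (suc k) + suc k           ≡⟨ unfold k (pentagonal k) ⟩
    (2 * pentagonal k + k) + (6 * k + 3)     ≡⟨ cong (_+ (6 * k + 3)) (pentagonal-double k) ⟩
    3 * (k * k) + (6 * k + 3)                ≡⟨ square k ⟩
    3 * (suc k * suc k)                      ∎
    where
    open ≡-Reasoning
    unfold : ∀ k p → 2 * suc (3 * k + p) + suc k ≡ (2 * p + k) + (6 * k + 3)
    unfold = solve-∀
    square : ∀ k → 3 * (k * k) + (6 * k + 3) ≡ 3 * (suc k * suc k)
    square = solve-∀

  pentagonalTerm-coeff : ∀ k m →
    pentagonalTerm k m ≡ sgn k ℤ.* (eqInd (2 * m) (3 * (k * k) + k) ℤ.+ eqInd (2 * m + k) (3 * (k * k)))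
  pentagonalTerm-coeff k m = trans (const-⊛ (sgn k) _ m) (cong (sgn k ℤ.*_) (cong₂ ℤ._+_
    (trans (X^-coeff (pentagonal k + k) m) (eqInd-resp-⇔ to⁺ from⁺))
    (trans (X^-coeff (pentagonal k) m) (eqInd-resp-⇔ to⁻ from⁻))))
    where
    p : ℕ
    p = pentagonal k
    twice⁺ : 2 * (p + k) ≡ 3 * (k * k) + k
    twice⁺ = trans (distribute p k) (cong (_+ k) (pentagonal-double k))
      where
      distribute : ∀ p k → 2 * (p + k) ≡ 2 * p + k + k
      distribute = solve-∀
    to⁺ : m ≡ p + k → 2 * m ≡ 3 * (k * k) + k
    to⁺ refl = twice⁺
    from⁺ : 2 * m ≡ 3 * (k * k) + k → m ≡ p + k
    from⁺ eq = ℕ.*-cancelˡ-≡ m (p + k) 2 (trans eq (sym twice⁺))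
    to⁻ : m ≡ p → 2 * m + k ≡ 3 * (k * k)
    to⁻ refl = pentagonal-double k
    from⁻ : 2 * m + k ≡ 3 * (k * k) → m ≡ p
    from⁻ eq = ℕ.*-cancelˡ-≡ m p 2 (ℕ.+-cancelʳ-≡ k (2 * m) (2 * p) (trans eq (sym (pentagonal-double k))))

  pentagonalSum-diagonal : ∀ m → pentagonalSum m m ≡ ω m
  pentagonalSum-diagonal zero    = refl
  pentagonalSum-diagonal (suc m) = trans (ℤP.+-identityˡ _)
    (trans (Σ₁-coeff pentagonalTerm (suc m) (suc m)) (sum1-cong (suc m) (λ k → pentagonalTerm-coeff (suc k) (suc m))))

  thetaTerm-coeff : ∀ j m → thetaTerm j m ≡ + 2 ℤ.* (sgn j ℤ.* eqInd m (j * j))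
  thetaTerm-coeff j m = trans (const-⊛ (+ 2) _ m)
    (cong (+ 2 ℤ.*_) (trans (const-⊛ (sgn j) _ m) (cong (sgn j ℤ.*_) (X^-coeff (j * j) m))))

  theta : Series
  theta zero    = 1ℤ
  theta (suc m) = + 2 ℤ.* (sgn (suc m) ℤ.* δs (suc m))

  thetaSum-diagonal : ∀ m → thetaSum m m ≡ theta m
  thetaSum-diagonal zero    = refl
  thetaSum-diagonal (suc m) = begin
    0ℤ ℤ.+ Σ₁ thetaTerm (suc m) (suc m)
      ≡⟨ ℤP.+-identityˡ _ ⟩
    Σ₁ thetaTerm (suc m) (suc m)
      ≡⟨ Σ₁-coeff thetaTerm (suc m) (suc m) ⟩
    sum1 (λ j → thetaTerm j (suc m)) (suc m)
      ≡⟨ sum1-cong (suc m) (λ j → thetaTerm-coeff (suc j) (suc m)) ⟩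
    sum1 (λ j → + 2 ℤ.* (sgn j ℤ.* eqInd (suc m) (j * j))) (suc m)
      ≡⟨ sum1-*ˡ (+ 2) (λ j → sgn j ℤ.* eqInd (suc m) (j * j)) (suc m) ⟩
    + 2 ℤ.* sum1 (λ j → sgn j ℤ.* eqInd (suc m) (j * j)) (suc m)
      ≡⟨ cong (+ 2 ℤ.*_) (sum1-signed-squares m (suc m)) ⟩
    theta (suc m)  ∎
    where open ≡-Reasoning

  theta≡rhsA : ∀ n → theta n ≡ rhsA n
  theta≡rhsA zero    = refl
  theta≡rhsA (suc n) with isSquareB (suc n) (suc n) | isEven (suc n) | sgn-isEven (suc n)
  ... | true  | true  | sgn≡1  = cong (λ s → + 2 ℤ.* (s ℤ.* 1ℤ)) sgn≡1
  ... | true  | false | sgn≡-1 = cong (λ s → + 2 ℤ.* (s ℤ.* 1ℤ)) sgn≡-1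
  ... | false | _     | _      = cong (+ 2 ℤ.*_) (ℤP.*-zeroʳ (sgn (suc n)))

  -- Passing to the limit

  𝟙-X^-≈[]𝟙 : ∀ {N e} → N < e → 𝟙-X^ e ≈[ N ] 𝟙
  𝟙-X^-≈[]𝟙 N<e m m≤N = trans (cong (λ y → 𝟙 m ℤ.+ ℤ.- y) (X^-≈[]𝟘 N<e m m≤N)) (ℤP.+-identityʳ (𝟙 m))

  𝟙+X^-≈[]𝟙 : ∀ {N e} → N < e → 𝟙+X^ e ≈[ N ] 𝟙
  𝟙+X^-≈[]𝟙 N<e m m≤N = trans (cong (λ y → 𝟙 m ℤ.+ y) (X^-≈[]𝟘 N<e m m≤N)) (ℤP.+-identityʳ (𝟙 m))

  eulerFunction : Series
  eulerFunction = diagonal eulerProduct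

  distinctPartitions : Series
  distinctPartitions m = + q m

  signedOddDistinctPartitions : Series
  signedOddDistinctPartitions m = sgn m ℤ.* + qq m

  eulerProduct-approximates : Approximates eulerProduct eulerFunction
  eulerProduct-approximates = stable⇒approximates-diagonal (∏-≈[]-stable 𝟙-X^_ 1 (λ N → 𝟙-X^-≈[]𝟙 ℕ.≤-refl))

  distinctPartsProduct-approximates : Approximates distinctPartsProduct distinctPartitions
  distinctPartsProduct-approximates = approximates-resp-≈
    (stable⇒approximates-diagonal (∏-≈[]-stable 𝟙+X^_ 1 (λ N → 𝟙+X^-≈[]𝟙 ℕ.≤-refl)))
    (λ m → distinctPartsProduct-coeff m m)

  oddPartsProduct-approximates : Approximates oddPartsProduct signedOddDistinctPartitions
  oddPartsProduct-approximates = approximates-resp-≈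
    (stable⇒approximates-diagonal
      (∏-≈[]-stable (λ i → 𝟙-X^ suc (2 * i)) 0 (λ N → 𝟙-X^-≈[]𝟙 (s≤s (ℕ.m≤m+n N (N + 0))))))
    (λ m → oddPartsProduct-coeff m m)

  pentagonalSum-approximates : Approximates pentagonalSum ω
  pentagonalSum-approximates = approximates-resp-≈
    (stable⇒approximates-diagonal
      (λ N → ⊕-cong-≈[] (≈⇒≈[] N (≈-refl {𝟙})) (Σ₁-≈[]-stable pentagonalTerm small N)))
    pentagonalSum-diagonal
    where
    small : ∀ N → pentagonalTerm (suc N) ≈[ N ] 𝟘
    small N = ⊛-≈[]𝟘ʳ (const (sgn (suc N)))
      (⊕-cong-≈[] (X^-≈[]𝟘 (ℕ.m≤n+m (suc N) (pentagonal (suc N))))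
                  (X^-≈[]𝟘 (s≤s (ℕ.≤-trans (ℕ.m≤m+n N (N + (N + 0))) (ℕ.m≤m+n (3 * N) (pentagonal N))))))

  thetaSum-approximates : Approximates thetaSum theta
  thetaSum-approximates = approximates-resp-≈
    (stable⇒approximates-diagonal
      (λ N → ⊕-cong-≈[] (≈⇒≈[] N (≈-refl {𝟙})) (Σ₁-≈[]-stable thetaTerm small N)))
    thetaSum-diagonal
    where
    small : ∀ N → thetaTerm (suc N) ≈[ N ] 𝟘
    small N = ⊛-≈[]𝟘ʳ (const (+ 2)) (⊛-≈[]𝟘ʳ (const (sgn (suc N))) (X^-≈[]𝟘 (ℕ.m≤m*n (suc N) (suc N))))

  pentagonal-number-theorem : eulerFunction ≈ ω
  pentagonal-number-theorem = approximates-unique eulerProduct-approximates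
    (approximates-≈[] (λ N → ≈[]-trans (≈[]-sym (shanks-≈[] N)) (≈⇒≈[] N (shanks N))) pentagonalSum-approximates)

  gauss-identity : distinctPartitions ⊛ theta ≈ eulerFunction
  gauss-identity = approximates-unique
    (approximates-⊛ distinctPartsProduct-approximates thetaSum-approximates)
    (approximates-≈[] (λ N → ≈[]-trans (≈⇒≈[] N (≈-sym (gauss N))) (gauss-≈[] N))
                      (λ N → approximates-beyond eulerProduct-approximates (ℕ.m≤m+n N N)))

  euler-odd-distinct-identity : signedOddDistinctPartitions ⊛ distinctPartitions ≈ 𝟙
  euler-odd-distinct-identity =
    ⊛-cancelʳ {u = eulerFunction} refl (≈-trans triple-product (≈-sym (⊛-identityˡ eulerFunction)))
    where
    finite : ∀ N → oddPartsProduct N ⊛ distinctPartsProduct N ⊛ eulerProduct N ≈ eulerProduct (2 * N)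
    finite N = ≈-trans (⊛-assoc (oddPartsProduct N) (distinctPartsProduct N) (eulerProduct N))
                       (≈-trans (⊛-cong (≈-refl {oddPartsProduct N}) (distinctPartsProduct-⊛-eulerProduct N))
                                (oddPartsProduct-⊛-evenPartsProduct N))
    triple-product : signedOddDistinctPartitions ⊛ distinctPartitions ⊛ eulerFunction ≈ eulerFunction
    triple-product = approximates-unique
      (approximates-⊛ (approximates-⊛ oddPartsProduct-approximates distinctPartsProduct-approximates)
                      eulerProduct-approximates)
      (approximates-≈[] (λ N → ≈⇒≈[] N (finite N))
                        (λ N → approximates-beyond eulerProduct-approximates (ℕ.m≤m+n N (N + 0))))

  theta-⊛-coeff : ∀ f n → (theta ⊛ f) n ≡ f n ℤ.+ + 2 ℤ.* sum1 (λ k → sgn k ℤ.* δs k ℤ.* f (n ∸ k)) n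
  theta-⊛-coeff f n = begin
    (theta ⊛ f) n
      ≡⟨ ⊛-coeff theta f n ⟩
    sum0 (λ k → theta k ℤ.* f (n ∸ k)) n
      ≡⟨ sum0-split (λ k → theta k ℤ.* f (n ∸ k)) n ⟩
    1ℤ ℤ.* f n ℤ.+ sum1 (λ k → theta k ℤ.* f (n ∸ k)) n
      ≡⟨ cong₂ ℤ._+_ (ℤP.*-identityˡ (f n))
                     (sum1-cong n (λ k → ℤP.*-assoc (+ 2) (sgn (suc k) ℤ.* δs (suc k)) (f (n ∸ suc k)))) ⟩
    f n ℤ.+ sum1 (λ k → + 2 ℤ.* (sgn k ℤ.* δs k ℤ.* f (n ∸ k))) n
      ≡⟨ cong (λ s → f n ℤ.+ s) (sum1-*ˡ (+ 2) (λ k → sgn k ℤ.* δs k ℤ.* f (n ∸ k)) n) ⟩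
    f n ℤ.+ + 2 ℤ.* sum1 (λ k → sgn k ℤ.* δs k ℤ.* f (n ∸ k)) n  ∎
    where open ≡-Reasoning

  theta-⊛-distinctPartitions : theta ⊛ distinctPartitions ≈ ω
  theta-⊛-distinctPartitions =
    ≈-trans (⊛-comm theta distinctPartitions) (≈-trans gauss-identity pentagonal-number-theorem)

  signedOddDistinctPartitions-⊛-ω : signedOddDistinctPartitions ⊛ ω ≈ theta
  signedOddDistinctPartitions-⊛-ω = begin
    E ⊛ ω             ≈⟨ ⊛-cong (≈-refl {E}) (≈-sym theta-⊛-distinctPartitions) ⟩
    E ⊛ (theta ⊛ D)   ≈⟨ solve 3 (λ E θ D → E :* (θ :* D) := (E :* D) :* θ) ≈-refl E theta D ⟩
    E ⊛ D ⊛ theta     ≈⟨ ⊛-cong euler-odd-distinct-identity (≈-refl {theta}) ⟩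
    𝟙 ⊛ theta         ≈⟨ ⊛-identityˡ theta ⟩
    theta             ∎
    where
    open ≈-Reasoning
    E D : Series
    E = signedOddDistinctPartitions
    D = distinctPartitions

open FormalPowerSeries using (⊛-coeff)
open PartitionIdentities
  using (signedOddDistinctPartitions; signedOddDistinctPartitions-⊛-ω; theta≡rhsA;
         distinctPartitions; theta-⊛-coeff; theta-⊛-distinctPartitions)
open import Data.Nat using (ℕ; _∸_)
open import Data.Integer using (+_; _+_; _*_)
open import Data.Product using (_×_; _,_)
open import Relation.Binary.PropositionalEquality using (_≡_; sym; trans)

theorem2 : ((n : ℕ) → sum0 (λ k → sgn k * (+ qq k) * ω (n ∸ k)) n ≡ rhsA n)
           × ((n : ℕ) → + q n + + 2 * sum1 (λ k → sgn k * δs k * + q (n ∸ k)) n ≡ ω n)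
theorem2 =
  (λ n → trans (sym (⊛-coeff signedOddDistinctPartitions ω n))
               (trans (signedOddDistinctPartitions-⊛-ω n) (theta≡rhsA n))) ,
  (λ n → trans (sym (theta-⊛-coeff distinctPartitions n)) (theta-⊛-distinctPartitions n))
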